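{- Let $\Sigma\colon\mathbb{C}\to\mathbb{C}$ be an endofunctor with an initial algebra $(\mu\Sigma,\iota)$ that preserves strong epimorphisms, and let $O\rightarrowtail\mu\Sigma\times\mu\Sigma$ be a preorder. If the contextual preorder $\lesssim_O$ (the greatest $O$-adequate congruence on $(\mu\Sigma,\iota)$) exists, then it is a preorder.
   Context: Standing assumptions: $\mathbb{C}$ is complete, has finite coproducts, is well-powered, monomorphisms are stable under finite coproducts, and strong epimorphisms are stable under pullback; hence every morphism has a (strong epi, mono)-factorization, whose mono part is its image. A relation on $X$ is a subobject $\langle l_R,r_R\rangle\colon R\rightarrowtail X\times X$; relations on $X$ form a complete lattice under $\leq$. $\Delta=\langle\mathrm{id},\mathrm{id}\rangle$. For $f\colon X\to Y$, $f_\star[R]$ is the image of $(f\times f)\circ\langle l_R,r_R\rangle$. The composite $R\cdot S$ is the image of $\langle l_R\circ\bar l,r_S\circ\bar r\rangle$ where $(\bar l,\bar r)$ is the pullback of $r_R$ and $l_S$. $R$ is reflexive if $\Delta\le R$, transitive if $R\cdot R\le R$, a preorder if both. The canonical lifting $\overline\Sigma R$ is the image of $\langle\Sigma l_R,\Sigma r_R\rangle\colon\Sigma R\to\Sigma X\times\Sigma X$. A congruence on a $\Sigma$-algebra $(A,a)$ is a relation $R$ on $A$ with $a_\star[\overline\Sigma R]\le R$. A relation $R$ on $\mu\Sigma$ is $O$-adequate if $R\le O$. -}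

module Defs where

open import Level using (Level; _⊔_; suc)
open import Data.Product using (Σ; ∃; _×_; _,_; proj₁; proj₂)
open import Relation.Binary.Structures using (IsEquivalence)

record Category (o ℓ e : Level) : Set (suc (o ⊔ ℓ ⊔ e)) where
  infix  4 _≈_
  infixr 9 _∘_
  field
    Obj : Set o
    _⇒_ : Obj → Obj → Set ℓ
    _≈_ : ∀ {A B} → A ⇒ B → A ⇒ B → Set e
    id  : ∀ {A} → A ⇒ A
    _∘_ : ∀ {A B C} → B ⇒ C → A ⇒ B → A ⇒ C
    ≈-equiv   : ∀ {A B} → IsEquivalence (_≈_ {A} {B})
    ∘-resp-≈  : ∀ {A B C} {f h : B ⇒ C} {g i : A ⇒ B} → f ≈ h → g ≈ i → f ∘ g ≈ h ∘ i
    assoc     : ∀ {A B C D} {f : A ⇒ B} {g : B ⇒ C} {h : C ⇒ D} → (h ∘ g) ∘ f ≈ h ∘ (g ∘ f)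
    identityˡ : ∀ {A B} {f : A ⇒ B} → id ∘ f ≈ f
    identityʳ : ∀ {A B} {f : A ⇒ B} → f ∘ id ≈ f

module _ {o ℓ e} (𝒞 : Category o ℓ e) where
  open Category 𝒞

  Mono : ∀ {A B} → A ⇒ B → Set (o ⊔ ℓ ⊔ e)
  Mono {A} f = ∀ {Z} (g h : Z ⇒ A) → f ∘ g ≈ f ∘ h → g ≈ h

  Epi : ∀ {A B} → A ⇒ B → Set (o ⊔ ℓ ⊔ e)
  Epi {B = B} f = ∀ {Z} (g h : B ⇒ Z) → g ∘ f ≈ h ∘ f → g ≈ h

  StrongEpi : ∀ {A B} → A ⇒ B → Set (o ⊔ ℓ ⊔ e)
  StrongEpi {A} {B} f =
    Epi f ×
    (∀ {C D} (m : C ⇒ D) → Mono m → (u : A ⇒ C) (v : B ⇒ D) → m ∘ u ≈ v ∘ f →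
       Σ (B ⇒ C) λ d → (d ∘ f ≈ u) × (m ∘ d ≈ v))

  record IsPullback {A B C P} (f : C ⇒ B) (g : A ⇒ B) (p : P ⇒ C) (q : P ⇒ A)
         : Set (o ⊔ ℓ ⊔ e) where
    field
      commute   : f ∘ p ≈ g ∘ q
      universal : ∀ {Z} (x : Z ⇒ C) (y : Z ⇒ A) → f ∘ x ≈ g ∘ y →
                  Σ (Z ⇒ P) λ u → (p ∘ u ≈ x) × (q ∘ u ≈ y)
      unique    : ∀ {Z} (u w : Z ⇒ P) → p ∘ u ≈ p ∘ w → q ∘ u ≈ q ∘ w → u ≈ w

  record BinaryProducts : Set (o ⊔ ℓ ⊔ e) where
    infixr 7 _×ₒ_
    field
      _×ₒ_ : Obj → Obj → Obj
      π₁   : ∀ {A B} → (A ×ₒ B) ⇒ A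
      π₂   : ∀ {A B} → (A ×ₒ B) ⇒ B
      ⟨_,_⟩ : ∀ {Z A B} → Z ⇒ A → Z ⇒ B → Z ⇒ (A ×ₒ B)
      project₁ : ∀ {Z A B} {f : Z ⇒ A} {g : Z ⇒ B} → π₁ ∘ ⟨ f , g ⟩ ≈ f
      project₂ : ∀ {Z A B} {f : Z ⇒ A} {g : Z ⇒ B} → π₂ ∘ ⟨ f , g ⟩ ≈ g
      unique   : ∀ {Z A B} {h : Z ⇒ (A ×ₒ B)} {f : Z ⇒ A} {g : Z ⇒ B} →
                 π₁ ∘ h ≈ f → π₂ ∘ h ≈ g → ⟨ f , g ⟩ ≈ h

  record Equalizers : Set (o ⊔ ℓ ⊔ e) where
    field
      Eq    : ∀ {A B} → A ⇒ B → A ⇒ B → Obj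
      eq    : ∀ {A B} (f g : A ⇒ B) → Eq f g ⇒ A
      eq-eq : ∀ {A B} (f g : A ⇒ B) → f ∘ eq f g ≈ g ∘ eq f g
      eq-univ : ∀ {A B Z} (f g : A ⇒ B) (h : Z ⇒ A) → f ∘ h ≈ g ∘ h →
                Σ (Z ⇒ Eq f g) λ u → eq f g ∘ u ≈ h
      eq-unique : ∀ {A B Z} (f g : A ⇒ B) (u w : Z ⇒ Eq f g) →
                  eq f g ∘ u ≈ eq f g ∘ w → u ≈ w

  record IndexedProducts (ι : Level) : Set (o ⊔ ℓ ⊔ e ⊔ suc ι) where
    field
      Π    : (I : Set ι) → (I → Obj) → Obj
      πᵢ   : ∀ {I} {X : I → Obj} (i : I) → Π I X ⇒ X i
      tup  : ∀ {I} {X : I → Obj} {Z} → ((i : I) → Z ⇒ X i) → Z ⇒ Π I X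
      tup-proj : ∀ {I} {X : I → Obj} {Z} (f : (i : I) → Z ⇒ X i) (i : I) →
                 πᵢ i ∘ tup f ≈ f i
      tup-unique : ∀ {I} {X : I → Obj} {Z} (u w : Z ⇒ Π I X) →
                   ((i : I) → πᵢ i ∘ u ≈ πᵢ i ∘ w) → u ≈ w

  record Initial : Set (o ⊔ ℓ ⊔ e) where
    field
      ⊥ₒ  : Obj
      ¡   : ∀ {A} → ⊥ₒ ⇒ A
      ¡-unique : ∀ {A} (f : ⊥ₒ ⇒ A) → ¡ ≈ f

  record BinaryCoproducts : Set (o ⊔ ℓ ⊔ e) where
    field
      _+ₒ_ : Obj → Obj → Obj
      i₁   : ∀ {A B} → A ⇒ (A +ₒ B)
      i₂   : ∀ {A B} → B ⇒ (A +ₒ B)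
      [_,_] : ∀ {A B Z} → A ⇒ Z → B ⇒ Z → (A +ₒ B) ⇒ Z
      inject₁ : ∀ {A B Z} {f : A ⇒ Z} {g : B ⇒ Z} → [ f , g ] ∘ i₁ ≈ f
      inject₂ : ∀ {A B Z} {f : A ⇒ Z} {g : B ⇒ Z} → [ f , g ] ∘ i₂ ≈ g
      unique  : ∀ {A B Z} {h : (A +ₒ B) ⇒ Z} {f : A ⇒ Z} {g : B ⇒ Z} →
                h ∘ i₁ ≈ f → h ∘ i₂ ≈ g → [ f , g ] ≈ h

    _+₁_ : ∀ {A B C D} → A ⇒ B → C ⇒ D → (A +ₒ C) ⇒ (B +ₒ D)
    f +₁ g = [ i₁ ∘ f , i₂ ∘ g ]

  record MonoInto (X : Obj) : Set (o ⊔ ℓ ⊔ e) where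
    field
      dom  : Obj
      arr  : dom ⇒ X
      mono : Mono arr

  _≤ₘ_ : ∀ {X} → MonoInto X → MonoInto X → Set (ℓ ⊔ e)
  m ≤ₘ n = Σ (MonoInto.dom m ⇒ MonoInto.dom n) λ h → MonoInto.arr n ∘ h ≈ MonoInto.arr m

  WellPowered : (ι : Level) → Set (o ⊔ ℓ ⊔ e ⊔ suc ι)
  WellPowered ι = ∀ X → Σ (Set ι) λ I → Σ (I → MonoInto X) λ s →
                  (m : MonoInto X) → Σ I λ i → (m ≤ₘ s i) × (s i ≤ₘ m)

record Setting (o ℓ e κ : Level) : Set (suc (o ⊔ ℓ ⊔ e ⊔ κ)) where
  field
    cat : Category o ℓ e
  open Category cat public
  field
    -- complete (binary products, equalizers and all ι-small products)
    products  : BinaryProducts cat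
    equalizers : Equalizers cat
    indexedProducts : IndexedProducts cat κ
    initial    : Initial cat
    coproducts : BinaryCoproducts cat
    wellPowered : WellPowered cat κ
  open BinaryProducts products public
  open Equalizers equalizers public
  open BinaryCoproducts coproducts public
    renaming (unique to +-unique; [_,_] to [_,_]ₒ)
  field
    mono-+ : ∀ {A B C D} {m : A ⇒ B} {n : C ⇒ D} →
             Mono cat m → Mono cat n → Mono cat (m +₁ n)
    strongEpi-pullback : ∀ {A B C P} {e : A ⇒ B} {f : C ⇒ B} {p : P ⇒ C} {q : P ⇒ A} →
                         StrongEpi cat e → IsPullback cat f e p q → StrongEpi cat p
    -- the (strong epi, mono)-factorization, which follows from the above
    Im     : ∀ {A B} → A ⇒ B → Obj
    im-epi : ∀ {A B} (f : A ⇒ B) → A ⇒ Im f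
    im     : ∀ {A B} (f : A ⇒ B) → Im f ⇒ B
    im-epi-strong : ∀ {A B} (f : A ⇒ B) → StrongEpi cat (im-epi f)
    im-mono : ∀ {A B} (f : A ⇒ B) → Mono cat (im f)
    im-factor : ∀ {A B} (f : A ⇒ B) → im f ∘ im-epi f ≈ f

module _ {o ℓ e κ} (𝒮 : Setting o ℓ e κ) where
  open Setting 𝒮

  Relation : Obj → Set (o ⊔ ℓ ⊔ e)
  Relation X = MonoInto cat (X ×ₒ X)

  module _ {X : Obj} (R : Relation X) where
    open MonoInto R
    lᵣ : dom ⇒ X
    lᵣ = π₁ ∘ arr
    rᵣ : dom ⇒ X
    rᵣ = π₂ ∘ arr

  _≤_ : ∀ {X} → Relation X → Relation X → Set (ℓ ⊔ e)
  _≤_ = _≤ₘ_ cat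

  image : ∀ {A B} → A ⇒ B → MonoInto cat B
  image f = record { dom = Im f ; arr = im f ; mono = im-mono f }

  Δ-mono : ∀ {X} → Mono cat (⟨ id {X} , id {X} ⟩)
  private
    ≈refl : ∀ {A B} {f : A ⇒ B} → f ≈ f
    ≈refl = IsEquivalence.refl ≈-equiv
    ≈sym : ∀ {A B} {f g : A ⇒ B} → f ≈ g → g ≈ f
    ≈sym = IsEquivalence.sym ≈-equiv
    ≈trans : ∀ {A B} {f g h : A ⇒ B} → f ≈ g → g ≈ h → f ≈ h
    ≈trans = IsEquivalence.trans ≈-equiv

  Δ-mono {X} g h p =
    let d : X ⇒ (X ×ₒ X)
        d = ⟨ id , id ⟩
        q₁ : π₁ {X} {X} ∘ d ≈ id
        q₁ = project₁
    in ≈trans (≈sym identityˡ)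
      (≈trans (∘-resp-≈ (≈sym q₁) ≈refl)
      (≈trans assoc
      (≈trans (∘-resp-≈ {f = π₁ {X} {X}} ≈refl p)
      (≈trans (≈sym assoc)
      (≈trans (∘-resp-≈ q₁ ≈refl) identityˡ)))))

  Δ : ∀ X → Relation X
  Δ X = record { dom = X ; arr = ⟨ id , id ⟩ ; mono = Δ-mono }

  _⋆[_] : ∀ {X Y} → X ⇒ Y → Relation X → Relation Y
  f ⋆[ R ] = image ⟨ f ∘ lᵣ R , f ∘ rᵣ R ⟩

  _·_ : ∀ {X} → Relation X → Relation X → Relation X
  R · S =
    let f = rᵣ R ∘ π₁
        g = lᵣ S ∘ π₂
        k = eq f g           -- pullback of r_R and l_S, as an equalizer
        l̄ = π₁ ∘ k
        r̄ = π₂ ∘ k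
    in image ⟨ lᵣ R ∘ l̄ , rᵣ S ∘ r̄ ⟩

  Reflexive : ∀ {X} → Relation X → Set (ℓ ⊔ e)
  Reflexive {X} R = Δ X ≤ R

  Transitive : ∀ {X} → Relation X → Set (ℓ ⊔ e)
  Transitive R = (R · R) ≤ R

  IsPreorder : ∀ {X} → Relation X → Set (ℓ ⊔ e)
  IsPreorder R = Reflexive R × Transitive R

  record Endofunctor : Set (o ⊔ ℓ ⊔ e) where
    field
      F₀ : Obj → Obj
      F₁ : ∀ {A B} → A ⇒ B → F₀ A ⇒ F₀ B
      F-resp-≈ : ∀ {A B} {f g : A ⇒ B} → f ≈ g → F₁ f ≈ F₁ g
      F-identity : ∀ {A} → F₁ (id {A}) ≈ id
      F-homomorphism : ∀ {A B C} {f : A ⇒ B} {g : B ⇒ C} → F₁ (g ∘ f) ≈ F₁ g ∘ F₁ f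

  module _ (F : Endofunctor) where
    open Endofunctor F

    PreservesStrongEpis : Set (o ⊔ ℓ ⊔ e)
    PreservesStrongEpis = ∀ {A B} (f : A ⇒ B) → StrongEpi cat f → StrongEpi cat (F₁ f)

    record InitialAlgebra : Set (o ⊔ ℓ ⊔ e) where
      field
        μ : Obj
        ι : F₀ μ ⇒ μ
        fold : ∀ {A} (a : F₀ A ⇒ A) → μ ⇒ A
        fold-hom : ∀ {A} (a : F₀ A ⇒ A) → fold a ∘ ι ≈ a ∘ F₁ (fold a)
        fold-unique : ∀ {A} (a : F₀ A ⇒ A) (h : μ ⇒ A) → h ∘ ι ≈ a ∘ F₁ h → h ≈ fold a

    lift : ∀ {X} → Relation X → Relation (F₀ X)
    lift R = image ⟨ F₁ (lᵣ R) , F₁ (rᵣ R) ⟩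

    IsCongruence : ∀ {A} → (F₀ A ⇒ A) → Relation A → Set (ℓ ⊔ e)
    IsCongruence a R = (a ⋆[ lift R ]) ≤ R

    module _ (I : InitialAlgebra) where
      open InitialAlgebra I

      Adequate : Relation μ → Relation μ → Set (ℓ ⊔ e)
      Adequate O R = R ≤ O

      IsContextualPreorder : Relation μ → Relation μ → Set (o ⊔ ℓ ⊔ e)
      IsContextualPreorder O R =
        (IsCongruence ι R × Adequate O R) ×
        ((S : Relation μ) → IsCongruence ι S → Adequate O S → S ≤ R)

-- The contextual preorder C is the greatest O-adequate congruence, so it suffices to show that the
-- diagonal Δ and the composite C · C are O-adequate congruences: then Δ ≤ C and C · C ≤ C. Adequacy
-- is reflexivity of O, respectively C · C ≤ O · O ≤ O. For the congruence property, a relation R on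
-- an algebra (A, a) is a congruence iff ⟨a ∘ Σ l_R, a ∘ Σ r_R⟩ factors through R, i.e. iff R is a
-- subalgebra of (A, a)²; Δ is one via a itself, and R · S inherits the structures of R and S once
-- Σ is applied to the strong epi from the pullback of r_R and l_S onto R · S, which Σ preserves.
module Submission where

open import Level using (Level; _⊔_)
open import Defs
open import Data.Product using (Σ; _×_; _,_)
open import Relation.Binary.Bundles using (Setoid)
open import Relation.Binary.Structures using (IsEquivalence)
import Relation.Binary.Reasoning.Setoid as SetoidReasoning

module Properties {o ℓ e κ} (𝒮 : Setting o ℓ e κ) where
  open Setting 𝒮
  open MonoInto

  module ≈ {A B : Obj} = IsEquivalence (≈-equiv {A} {B})

  hom-setoid : Obj → Obj → Setoid ℓ e
  hom-setoid A B = record { Carrier = A ⇒ B ; _≈_ = _≈_ ; isEquivalence = ≈-equiv }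

  module HomReasoning {A B : Obj} = SetoidReasoning (hom-setoid A B)
  open HomReasoning

  ∘-resp-≈ˡ : ∀ {A B C} {f h : B ⇒ C} {g : A ⇒ B} → f ≈ h → f ∘ g ≈ h ∘ g
  ∘-resp-≈ˡ p = ∘-resp-≈ p ≈.refl

  ∘-resp-≈ʳ : ∀ {A B C} {f : B ⇒ C} {g i : A ⇒ B} → g ≈ i → f ∘ g ≈ f ∘ i
  ∘-resp-≈ʳ p = ∘-resp-≈ ≈.refl p

  pullʳ : ∀ {A B C D} {k : C ⇒ D} {g : B ⇒ C} {f : A ⇒ B} {h : A ⇒ C} →
          g ∘ f ≈ h → (k ∘ g) ∘ f ≈ k ∘ h
  pullʳ p = ≈.trans assoc (∘-resp-≈ʳ p)

  pullˡ : ∀ {A B C D} {g : C ⇒ D} {f : B ⇒ C} {k : A ⇒ B} {h : B ⇒ D} →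
          g ∘ f ≈ h → g ∘ (f ∘ k) ≈ h ∘ k
  pullˡ p = ≈.trans (≈.sym assoc) (∘-resp-≈ˡ p)

  ⟨⟩∘ : ∀ {Z W A B} {f : Z ⇒ A} {g : Z ⇒ B} {h : W ⇒ Z} →
        ⟨ f , g ⟩ ∘ h ≈ ⟨ f ∘ h , g ∘ h ⟩
  ⟨⟩∘ = ≈.sym (unique (pullˡ project₁) (pullˡ project₂))

  ⟨⟩-cong₂ : ∀ {Z A B} {f f′ : Z ⇒ A} {g g′ : Z ⇒ B} → f ≈ f′ → g ≈ g′ →
             ⟨ f , g ⟩ ≈ ⟨ f′ , g′ ⟩
  ⟨⟩-cong₂ p q = unique (≈.trans project₁ (≈.sym p)) (≈.trans project₂ (≈.sym q))

  _FactorsThrough_ : ∀ {B Y} → B ⇒ Y → MonoInto cat Y → Set (ℓ ⊔ e)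
  _FactorsThrough_ {B} g m = Σ (B ⇒ dom m) λ d → arr m ∘ d ≈ g

  factorsThrough-resp-≈ : ∀ {B Y} {g g′ : B ⇒ Y} {m : MonoInto cat Y} →
                          g ≈ g′ → g FactorsThrough m → g′ FactorsThrough m
  factorsThrough-resp-≈ p (d , q) = d , ≈.trans q p

  factorsThrough-∘ : ∀ {A B Y} {g : B ⇒ Y} {m : MonoInto cat Y} (f : A ⇒ B) →
                     g FactorsThrough m → (g ∘ f) FactorsThrough m
  factorsThrough-∘ f (d , q) = d ∘ f , ≈.trans (≈.sym assoc) (∘-resp-≈ˡ q)

  factorsThrough-cancel-strongEpi : ∀ {A B Y} {g : B ⇒ Y} {m : MonoInto cat Y} {ε : A ⇒ B} →
                                    StrongEpi cat ε → (g ∘ ε) FactorsThrough m → g FactorsThrough m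
  factorsThrough-cancel-strongEpi {m = m} (_ , fill) (d , q) =
    let (d′ , _ , q′) = fill (arr m) (mono m) d _ q in d′ , q′

  factorsThrough-image : ∀ {B Y} (g : B ⇒ Y) → g FactorsThrough image 𝒮 g
  factorsThrough-image g = im-epi g , im-factor g

  image-least : ∀ {B Y} {g : B ⇒ Y} {m : MonoInto cat Y} → g FactorsThrough m → _≤ₘ_ cat (image 𝒮 g) m
  image-least {g = g} {m} p =
    factorsThrough-cancel-strongEpi {m = m} (im-epi-strong g)
      (factorsThrough-resp-≈ {m = m} (≈.sym (im-factor g)) p)

  ≤ₘ-trans : ∀ {X} {m n p : MonoInto cat X} → _≤ₘ_ cat m n → _≤ₘ_ cat n p → _≤ₘ_ cat m p
  ≤ₘ-trans {p = p} (h , q) n≤p = factorsThrough-resp-≈ {m = p} q (factorsThrough-∘ {m = p} h n≤p)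

  module _ {X : Obj} (R S : Relation 𝒮 X) where
    ·-apex : Obj
    ·-apex = Eq (rᵣ 𝒮 R ∘ π₁) (lᵣ 𝒮 S ∘ π₂)

    ·-fst : ·-apex ⇒ dom R
    ·-fst = π₁ ∘ eq (rᵣ 𝒮 R ∘ π₁) (lᵣ 𝒮 S ∘ π₂)

    ·-snd : ·-apex ⇒ dom S
    ·-snd = π₂ ∘ eq (rᵣ 𝒮 R ∘ π₁) (lᵣ 𝒮 S ∘ π₂)

  module _ {X : Obj} {R S : Relation 𝒮 X} where
    ·-commute : rᵣ 𝒮 R ∘ ·-fst R S ≈ lᵣ 𝒮 S ∘ ·-snd R S
    ·-commute = begin
      rᵣ 𝒮 R ∘ (π₁ ∘ k)   ≈⟨ ≈.sym assoc ⟩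
      (rᵣ 𝒮 R ∘ π₁) ∘ k   ≈⟨ eq-eq _ _ ⟩
      (lᵣ 𝒮 S ∘ π₂) ∘ k   ≈⟨ assoc ⟩
      lᵣ 𝒮 S ∘ (π₂ ∘ k)   ∎
      where
      k : ·-apex R S ⇒ (dom R ×ₒ dom S)
      k = eq (rᵣ 𝒮 R ∘ π₁) (lᵣ 𝒮 S ∘ π₂)

    ·-universal : ∀ {Z} {x : Z ⇒ dom R} {y : Z ⇒ dom S} → rᵣ 𝒮 R ∘ x ≈ lᵣ 𝒮 S ∘ y →
                  Σ (Z ⇒ ·-apex R S) λ u → (·-fst R S ∘ u ≈ x) × (·-snd R S ∘ u ≈ y)
    ·-universal {x = x} {y} p =
      let (u , ku) = eq-univ _ _ ⟨ x , y ⟩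
                       (≈.trans (pullʳ project₁) (≈.trans p (≈.sym (pullʳ project₂))))
      in u , ≈.trans (pullʳ ku) project₁ , ≈.trans (pullʳ ku) project₂

    ·-intro : ∀ {Z} {x : Z ⇒ dom R} {y : Z ⇒ dom S} → rᵣ 𝒮 R ∘ x ≈ lᵣ 𝒮 S ∘ y →
              ⟨ lᵣ 𝒮 R ∘ x , rᵣ 𝒮 S ∘ y ⟩ FactorsThrough _·_ 𝒮 R S
    ·-intro p =
      let (u , fst-u , snd-u) = ·-universal p
      in factorsThrough-resp-≈ {m = _·_ 𝒮 R S} (≈.trans ⟨⟩∘ (⟨⟩-cong₂ (pullʳ fst-u) (pullʳ snd-u)))
           (factorsThrough-∘ {m = _·_ 𝒮 R S} u (factorsThrough-image _))

  ·-mono : ∀ {X} {R R′ S S′ : Relation 𝒮 X} → _≤_ 𝒮 R R′ → _≤_ 𝒮 S S′ →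
           _≤_ 𝒮 (_·_ 𝒮 R S) (_·_ 𝒮 R′ S′)
  ·-mono {R = R} {R′} {S} {S′} (hR , pR) (hS , pS) =
    image-least {m = _·_ 𝒮 R′ S′}
      (factorsThrough-resp-≈ {m = _·_ 𝒮 R′ S′} (⟨⟩-cong₂ (pullˡ (pullʳ pR)) (pullˡ (pullʳ pS)))
                                              (·-intro {R = R′} {S′} R′S′-commute))
    where
    R′S′-commute : rᵣ 𝒮 R′ ∘ (hR ∘ ·-fst R S) ≈ lᵣ 𝒮 S′ ∘ (hS ∘ ·-snd R S)
    R′S′-commute = begin
      rᵣ 𝒮 R′ ∘ (hR ∘ ·-fst R S)  ≈⟨ pullˡ (pullʳ pR) ⟩
      rᵣ 𝒮 R ∘ ·-fst R S          ≈⟨ ·-commute {R = R} {S} ⟩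
      lᵣ 𝒮 S ∘ ·-snd R S          ≈⟨ ≈.sym (pullˡ (pullʳ pS)) ⟩
      lᵣ 𝒮 S′ ∘ (hS ∘ ·-snd R S)  ∎

  ·-≤-transitive : ∀ {X} {R S O : Relation 𝒮 X} → Transitive 𝒮 O → _≤_ 𝒮 R O → _≤_ 𝒮 S O →
                   _≤_ 𝒮 (_·_ 𝒮 R S) O
  ·-≤-transitive {R = R} {S} {O} O-trans R≤O S≤O =
    ≤ₘ-trans {m = _·_ 𝒮 R S} {_·_ 𝒮 O O} {O} (·-mono {R = R} {O} {S} {O} R≤O S≤O) O-trans

  module _ {Y B : Obj} {f g : Y ⇒ B} where
    lᵣ-image : lᵣ 𝒮 (image 𝒮 ⟨ f , g ⟩) ∘ im-epi ⟨ f , g ⟩ ≈ f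
    lᵣ-image = ≈.trans (pullʳ (im-factor _)) project₁

    rᵣ-image : rᵣ 𝒮 (image 𝒮 ⟨ f , g ⟩) ∘ im-epi ⟨ f , g ⟩ ≈ g
    rᵣ-image = ≈.trans (pullʳ (im-factor _)) project₂

    ⋆-image-cover : ∀ {A} (a : B ⇒ A) →
                    ⟨ a ∘ lᵣ 𝒮 (image 𝒮 ⟨ f , g ⟩) , a ∘ rᵣ 𝒮 (image 𝒮 ⟨ f , g ⟩) ⟩ ∘ im-epi ⟨ f , g ⟩
                      ≈ ⟨ a ∘ f , a ∘ g ⟩
    ⋆-image-cover a = ≈.trans ⟨⟩∘ (⟨⟩-cong₂ (pullʳ lᵣ-image) (pullʳ rᵣ-image))

  module _ {X Z : Obj} {R : Relation 𝒮 X} {c : Z ⇒ dom R} {u v : Z ⇒ X} (p : arr R ∘ c ≈ ⟨ u , v ⟩) where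
    lᵣ-factor : lᵣ 𝒮 R ∘ c ≈ u
    lᵣ-factor = ≈.trans (pullʳ p) project₁

    rᵣ-factor : rᵣ 𝒮 R ∘ c ≈ v
    rᵣ-factor = ≈.trans (pullʳ p) project₂

  module _ (F : Endofunctor 𝒮) where
    open Endofunctor F

    ∘-F₁-∘ : ∀ {A B C D} {a : F₀ C ⇒ D} {f : B ⇒ C} {g : A ⇒ B} → (a ∘ F₁ f) ∘ F₁ g ≈ a ∘ F₁ (f ∘ g)
    ∘-F₁-∘ = ≈.trans assoc (∘-resp-≈ʳ (≈.sym F-homomorphism))

    hom-∘-F₁ : ∀ {A B C} {a : F₀ A ⇒ A} {c : F₀ B ⇒ B} {f : B ⇒ A} {p : C ⇒ B} →
               f ∘ c ≈ a ∘ F₁ f → f ∘ (c ∘ F₁ p) ≈ a ∘ F₁ (f ∘ p)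
    hom-∘-F₁ q = ≈.trans (pullˡ q) ∘-F₁-∘

    ClosedUnder : ∀ {A} → F₀ A ⇒ A → Relation 𝒮 A → Set (ℓ ⊔ e)
    ClosedUnder a R = ⟨ a ∘ F₁ (lᵣ 𝒮 R) , a ∘ F₁ (rᵣ 𝒮 R) ⟩ FactorsThrough R

    module _ {A : Obj} {a : F₀ A ⇒ A} {R : Relation 𝒮 A} where
      closed⇒isCongruence : ClosedUnder a R → IsCongruence 𝒮 F a R
      closed⇒isCongruence closed =
        image-least {m = R} (factorsThrough-cancel-strongEpi {m = R} (im-epi-strong _)
          (factorsThrough-resp-≈ {m = R} (≈.sym (⋆-image-cover a)) closed))

      isCongruence⇒closed : IsCongruence 𝒮 F a R → ClosedUnder a R
      isCongruence⇒closed congruence =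
        factorsThrough-resp-≈ {m = R} (≈.trans (pullˡ (im-factor _)) (⋆-image-cover a))
          (factorsThrough-∘ {m = R} (im-epi _ ∘ im-epi _) congruence)

    Δ-closed : ∀ {A} (a : F₀ A ⇒ A) → ClosedUnder a (Δ 𝒮 A)
    Δ-closed {A} a = a , (begin
      ⟨ id , id ⟩ ∘ a                                   ≈⟨ ⟨⟩∘ ⟩
      ⟨ id ∘ a , id ∘ a ⟩                               ≈⟨ ⟨⟩-cong₂ identityˡ identityˡ ⟩
      ⟨ a , a ⟩                                         ≈⟨ ⟨⟩-cong₂ (≈.sym (∘-F₁-id project₁))
                                                                   (≈.sym (∘-F₁-id project₂)) ⟩
      ⟨ a ∘ F₁ (π₁ ∘ ⟨ id , id ⟩) , a ∘ F₁ (π₂ ∘ ⟨ id , id ⟩) ⟩ ∎)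
      where
      ∘-F₁-id : ∀ {f : A ⇒ A} → f ≈ id → a ∘ F₁ f ≈ a
      ∘-F₁-id p = ≈.trans (∘-resp-≈ʳ (≈.trans (F-resp-≈ p) F-identity)) identityʳ

    ·-closed : PreservesStrongEpis 𝒮 F → ∀ {A} {a : F₀ A ⇒ A} {R S : Relation 𝒮 A} →
               ClosedUnder a R → ClosedUnder a S → ClosedUnder a (_·_ 𝒮 R S)
    ·-closed preserves {A} {a} {R} {S} (cR , pR) (cS , pS) =
      factorsThrough-cancel-strongEpi {m = RS} (preserves _ (im-epi-strong _))
        (factorsThrough-resp-≈ {m = RS} cover (·-intro {R = R} {S} commute))
      where
      RS : Relation 𝒮 A
      RS = _·_ 𝒮 R S

      x : F₀ (·-apex R S) ⇒ dom R
      x = cR ∘ F₁ (·-fst R S)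

      y : F₀ (·-apex R S) ⇒ dom S
      y = cS ∘ F₁ (·-snd R S)

      commute : rᵣ 𝒮 R ∘ x ≈ lᵣ 𝒮 S ∘ y
      commute = begin
        rᵣ 𝒮 R ∘ x                    ≈⟨ hom-∘-F₁ (rᵣ-factor {R = R} pR) ⟩
        a ∘ F₁ (rᵣ 𝒮 R ∘ ·-fst R S)   ≈⟨ ∘-resp-≈ʳ (F-resp-≈ (·-commute {R = R} {S})) ⟩
        a ∘ F₁ (lᵣ 𝒮 S ∘ ·-snd R S)   ≈⟨ ≈.sym (hom-∘-F₁ (lᵣ-factor {R = S} pS)) ⟩
        lᵣ 𝒮 S ∘ y                    ∎

      cover : ⟨ lᵣ 𝒮 R ∘ x , rᵣ 𝒮 S ∘ y ⟩ ≈ ⟨ a ∘ F₁ (lᵣ 𝒮 RS) , a ∘ F₁ (rᵣ 𝒮 RS) ⟩ ∘ F₁ (im-epi _)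
      cover = begin
        ⟨ lᵣ 𝒮 R ∘ x , rᵣ 𝒮 S ∘ y ⟩
          ≈⟨ ⟨⟩-cong₂ (hom-∘-F₁ (lᵣ-factor {R = R} pR)) (hom-∘-F₁ (rᵣ-factor {R = S} pS)) ⟩
        ⟨ a ∘ F₁ (lᵣ 𝒮 R ∘ ·-fst R S) , a ∘ F₁ (rᵣ 𝒮 S ∘ ·-snd R S) ⟩
          ≈⟨ ⟨⟩-cong₂ (∘-resp-≈ʳ (F-resp-≈ (≈.sym lᵣ-image))) (∘-resp-≈ʳ (F-resp-≈ (≈.sym rᵣ-image))) ⟩
        ⟨ a ∘ F₁ (lᵣ 𝒮 RS ∘ im-epi _) , a ∘ F₁ (rᵣ 𝒮 RS ∘ im-epi _) ⟩
          ≈⟨ ≈.sym (≈.trans ⟨⟩∘ (⟨⟩-cong₂ ∘-F₁-∘ ∘-F₁-∘)) ⟩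
        ⟨ a ∘ F₁ (lᵣ 𝒮 RS) , a ∘ F₁ (rᵣ 𝒮 RS) ⟩ ∘ F₁ (im-epi _)
          ∎

    Δ-isCongruence : ∀ {A} (a : F₀ A ⇒ A) → IsCongruence 𝒮 F a (Δ 𝒮 A)
    Δ-isCongruence {A} a = closed⇒isCongruence {R = Δ 𝒮 A} (Δ-closed a)

    ·-isCongruence : PreservesStrongEpis 𝒮 F → ∀ {A} {a : F₀ A ⇒ A} {R S : Relation 𝒮 A} →
                     IsCongruence 𝒮 F a R → IsCongruence 𝒮 F a S → IsCongruence 𝒮 F a (_·_ 𝒮 R S)
    ·-isCongruence preserves {R = R} {S} R-congruence S-congruence =
      closed⇒isCongruence {R = _·_ 𝒮 R S}
        (·-closed preserves {R = R} {S} (isCongruence⇒closed {R = R} R-congruence)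
                                        (isCongruence⇒closed {R = S} S-congruence))

proposition4p13 : ∀ {o ℓ e ι : Level} (𝒮 : Setting o ℓ e ι) (F : Endofunctor 𝒮) →
                  PreservesStrongEpis 𝒮 F → (I : InitialAlgebra 𝒮 F) →
                  (O : Relation 𝒮 (InitialAlgebra.μ I)) → IsPreorder 𝒮 O →
                  (C : Relation 𝒮 (InitialAlgebra.μ I)) →
                  IsContextualPreorder 𝒮 F I O C → IsPreorder 𝒮 C
proposition4p13 𝒮 F preserves I O (O-refl , O-trans) C ((C-congruence , C-adequate) , C-greatest) =
  C-greatest (Δ 𝒮 μ) (Δ-isCongruence F ι) O-refl ,
  C-greatest (_·_ 𝒮 C C) (·-isCongruence F preserves {R = C} {C} C-congruence C-congruence)
             (·-≤-transitive {R = C} {C} {O} O-trans C-adequate C-adequate)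
  where
  open Properties 𝒮
  open InitialAlgebra I
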